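{- Let $(m,n)$ be a coprime pair of positive integers and let $\Sigma$ be the $(S,W)$-word of some $D\in\mathcal D_{m,n}$. Let $R^{(0)}$ be the canonical starting sequence for $\Sigma$ and let $\widetilde R$ be the canonical rank sequence for $\Sigma$. If $R$ is any weakly increasing sequence satisfying $R^{(0)}\preceq R\preceq\widetilde R$, then the WeakFindRank algorithm with starting path diagram $T(\Sigma,R)$ terminates and outputs the rank sequence $\widetilde R$.
   Context: $(m,n)$-Dyck paths: lattice paths from $(0,0)$ to $(m,n)$ with $n$ North and $m$ East unit steps staying weakly above $y=nx/m$; $\mathcal D_{m,n}$ is their set. The $(S,W)$-word of a path writes $S$ for each North step and $W$ for each East step. Path diagram $T(\Sigma,R)$ for a word $\Sigma=\Sigma_1\cdots\Sigma_{m+n}$ with $n$ letters $S$ and $m$ letters $W$ and an integer sequence $R=(r_1,\dots,r_{m+n})$: arrows $A_1,\dots,A_{m+n}$, where $A_i$ goes from $(i-1,r_i)$ to $(i,r_i+m)$ (red) if $\Sigma_i=S$ and from $(i-1,r_i)$ to $(i,r_i-n)$ (blue) if $\Sigma_i=W$; $A_i$ starts at level $r_i$. Row $j$ ($j\in\mathbb Z$) is the strip between $y=j$ and $y=j+1$; a red arrow with starting rank $r$ has a segment in rows $r,\dots,r+m-1$, a blue one in rows $r-n,\dots,r-1$. The row count $c(j)$ is the number of red minus the number of blue arrows having a segment in row $j$. WeakFindRank algorithm from a weakly increasing nonnegative sequence: repeat: if all row counts of $T(\Sigma,R)$ are $\le 0$, stop and output $R$; otherwise let $j$ be the lowest row with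 $c(j)>0$, let $i$ be the largest index with $r_i=j$, and replace $r_i$ by $r_i+1$. For sequences $R=(r_i)$, $R'=(r'_i)$ of length $m+n$, $R\preceq R'$ means $r_i\le r'_i$ for all $i$. The canonical starting sequence $R^{(0)}$ for $\Sigma$ is obtained from $\Sigma$ by replacing each letter of the initial maximal run of $S$'s by $0$ and every remaining letter by $m$. The canonical rank sequence $\widetilde R$ for $\Sigma$ is defined as follows: run WeakFindRank from $R^{(0)}$ (it terminates), obtaining $\overline R=(\overline r_1,\dots,\overline r_{m+n})$, and set $\widetilde R=(\overline r_1-\overline r_1,\overline r_2-\overline r_1,\dots,\overline r_{m+n}-\overline r_1)$. -}

module Defs where

open import Data.Nat as ℕ using (ℕ; zero; suc)
open import Data.Integer as ℤ using (ℤ; +_; _-_; _+_; 0ℤ; 1ℤ; -1ℤ; _≤?_; _<?_)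
open import Data.Fin as Fin using (Fin)
open import Data.List as List using (List; []; _∷_; length; take)
open import Data.Vec as Vec using (Vec; []; _∷_; lookup; zipWith; updateAt; fromList; replicate)
open import Data.Bool using (if_then_else_; _∧_)
open import Data.Product using (Σ; Σ-syntax; _×_)
open import Relation.Nullary.Decidable using (⌊_⌋)
open import Relation.Binary.PropositionalEquality using (_≡_)
open import Relation.Binary.Construct.Closure.ReflexiveTransitive using (Star)

-- Letters of the (S,W)-word: S = North step, W = East step.
data Letter : Set where
  S W : Letter

countS : List Letter → ℕ
countS []      = 0
countS (S ∷ w) = suc (countS w)
countS (W ∷ w) = countS w

countW : List Letter → ℕ
countW []      = 0
countW (S ∷ w) = countW w
countW (W ∷ w) = suc (countW w)

-- w is the (S,W)-word of an (m,n)-Dyck path: n North steps, m East steps,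
-- and every lattice point (x,y) on the path satisfies y ≥ n x / m, i.e. n x ≤ m y.
IsDyckWord : ℕ → ℕ → List Letter → Set
IsDyckWord m n w =
  countS w ≡ n × countW w ≡ m ×
  (∀ k → n ℕ.* countW (take k w) ℕ.≤ m ℕ.* countS (take k w))

-- Contribution of arrow with letter l and starting rank r to row j.
-- red (S): segments in rows r, …, r+m-1 ; blue (W): rows r-n, …, r-1.
contrib : ℕ → ℕ → ℤ → Letter → ℤ → ℤ
contrib m n j S r = if ⌊ r ≤? j ⌋ ∧ ⌊ j <? r + + m ⌋ then 1ℤ else 0ℤ
contrib m n j W r = if ⌊ r - + n ≤? j ⌋ ∧ ⌊ j <? r ⌋ then -1ℤ else 0ℤ

sumℤ : ∀ {k} → Vec ℤ k → ℤ
sumℤ []       = 0ℤ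
sumℤ (x ∷ xs) = x + sumℤ xs

rowCount : ℕ → ℕ → (w : List Letter) → Vec ℤ (length w) → ℤ → ℤ
rowCount m n w R j = sumℤ (zipWith (contrib m n j) (fromList w) R)

Stopped : ℕ → ℕ → (w : List Letter) → Vec ℤ (length w) → Set
Stopped m n w R = ∀ j → rowCount m n w R j ℤ.≤ 0ℤ

Step : ℕ → ℕ → (w : List Letter) → Vec ℤ (length w) → Vec ℤ (length w) → Set
Step m n w R R' =
  Σ[ j ∈ ℤ ] Σ[ i ∈ Fin (length w) ]
    (0ℤ ℤ.< rowCount m n w R j) ×
    (∀ j' → j' ℤ.< j → rowCount m n w R j' ℤ.≤ 0ℤ) ×
    (lookup R i ≡ j) ×
    (∀ k → lookup R k ≡ j → k Fin.≤ i) ×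
    (R' ≡ updateAt R i (λ r → r + 1ℤ))

WeakFindRankOutputs : ℕ → ℕ → (w : List Letter) → Vec ℤ (length w) → Vec ℤ (length w) → Set
WeakFindRankOutputs m n w R R' = Star (Step m n w) R R' × Stopped m n w R'

canonStart : ℕ → (w : List Letter) → Vec ℤ (length w)
canonStart m []      = []
canonStart m (S ∷ w) = 0ℤ ∷ canonStart m w
canonStart m (W ∷ w) = replicate (suc (length w)) (+ m)

normalize : ∀ {k} → Vec ℤ k → Vec ℤ k
normalize []       = []
normalize (x ∷ xs) = Vec.map (λ y → y - x) (x ∷ xs)

IsCanonicalRank : ℕ → ℕ → (w : List Letter) → Vec ℤ (length w) → Set
IsCanonicalRank m n w Rt =
  Σ[ Rbar ∈ Vec ℤ (length w) ]
    WeakFindRankOutputs m n w (canonStart m w) Rbar × Rt ≡ normalize Rbar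

_⪯_ : ∀ {k} → Vec ℤ k → Vec ℤ k → Set
R ⪯ R' = ∀ i → lookup R i ℤ.≤ lookup R' i

WeaklyIncreasing : ∀ {k} → Vec ℤ k → Set
WeaklyIncreasing R = ∀ i j → i Fin.≤ j → lookup R i ℤ.≤ lookup R j

-- A step of WeakFindRank raises the start of the last arrow on the lowest positive row j.
-- Let B be weakly increasing with all row counts ≤ 0 and Q ⪯ B weakly increasing. That arrow
-- starts strictly lower in Q than in B: otherwise every arrow starting at or below row j in Q
-- also does so in B, whence c_Q(j) ≤ c_B(j) ≤ 0. So runs from weakly increasing starts never
-- overtake such a B, and they reach it in finitely many steps since Σ (B − Q) drops by one per
-- step. Consequently the output from R⁰ and the output from any R between R⁰ and it bound each
-- other, hence coincide. The canonical rank sequence is a translate of the output R̄ from R⁰,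
-- so it is stopped too; as it lies above R⁰ it also lies above R̄, which forces r̄₁ = 0, i.e. it is R̄.

module Submission where

open import Defs

module _ where
  open import Data.Bool using (if_then_else_; _∧_)
  open import Data.Fin as Fin using (Fin; zero; suc)
  open import Data.Fin.Properties as Fin using (any?)
  open import Data.Integer as ℤ
    using (ℤ; +_; -[1+_]; _+_; _-_; -_; 0ℤ; 1ℤ; -1ℤ; pred; ∣_∣; _≤_; _<_; _≤?_; _<?_; +≤+; -≤+)
  open import Data.Integer.Properties
  open import Algebra.Properties.CommutativeSemigroup +-commutativeSemigroup
    using (x∙yz≈y∙xz; xy∙z≈xz∙y; xy∙z≈y∙xz)
  open import Data.Integer.Tactic.RingSolver using (solve-∀)
  open import Data.List as List using (List; length)
  open import Data.Nat as ℕ using (ℕ; zero; suc)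
  import Data.Nat.Properties as ℕ
  open import Data.Product using (∃; ∃-syntax; _×_; _,_; proj₁; proj₂)
  open import Data.Sum using (_⊎_; inj₁; inj₂)
  open import Data.Vec using (Vec; []; _∷_; lookup; map; zipWith; updateAt; fromList)
  open import Data.Vec.Properties
    using (lookup-map; lookup-zipWith; lookup∘updateAt; lookup∘updateAt′; map-id; map-cong; lookup-replicate)
  open import Data.Vec.Relation.Binary.Pointwise.Extensional using (ext; Pointwise-≡⇒≡)
  open import Function using (_∘_)
  open import Relation.Binary.Construct.Closure.ReflexiveTransitive using (Star; ε; _◅_; fold)
  open import Relation.Binary.PropositionalEquality
    using (_≡_; _≢_; refl; sym; trans; cong; subst; subst₂)
  open import Relation.Nullary using (Dec; yes; no; ¬_; contradiction)
  open import Relation.Nullary.Decidable using (⌊_⌋; _×-dec_)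
  open import Relation.Unary using (Pred; Decidable)

  if-∧-yes : {A B C : Set} {x y : C} (a? : Dec A) (b? : Dec B) →
             A → B → (if ⌊ a? ⌋ ∧ ⌊ b? ⌋ then x else y) ≡ x
  if-∧-yes (yes _) (yes _) _ _ = refl
  if-∧-yes (yes _) (no ¬b) _ b = contradiction b ¬b
  if-∧-yes (no ¬a) _       a _ = contradiction a ¬a

  if-∧-no : {A B C : Set} {x y : C} (a? : Dec A) (b? : Dec B) →
            ¬ (A × B) → (if ⌊ a? ⌋ ∧ ⌊ b? ⌋ then x else y) ≡ y
  if-∧-no (yes a) (yes b) ¬ab = contradiction (a , b) ¬ab
  if-∧-no (yes _) (no _)  _   = refl
  if-∧-no (no _)  _       _   = refl

  i≤+∣i∣ : ∀ i → i ≤ + ∣ i ∣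
  i≤+∣i∣ (+ _)    = ≤-refl
  i≤+∣i∣ -[1+ _ ] = -≤+

  i-j+j≡i : ∀ i j → i - j + j ≡ i
  i-j+j≡i = solve-∀

  i+j-j≡i : ∀ i j → i + j - j ≡ i
  i+j-j≡i = solve-∀

  least-counterexample : ∀ {p} (P : Pred ℤ p) → Decidable P → (a : ℤ) (k : ℕ) →
    (∀ j → j < a → P j) → (∀ j → a + + k ≤ j → P j) →
    (∀ j → P j) ⊎ ∃[ j ] ¬ P j × (∀ j′ → j′ < j → P j′)
  least-counterexample P P? a zero below above = inj₁ everywhere
    where
    everywhere : ∀ j → P j
    everywhere j with j <? a
    ... | yes j<a = below j j<a
    ... | no  j≮a = above j (subst (_≤ j) (sym (+-identityʳ a)) (≮⇒≥ j≮a))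
  least-counterexample P P? a (suc k) below above with P? a
  ... | no  ¬Pa = inj₂ (a , ¬Pa , below)
  ... | yes Pa  = least-counterexample P P? (ℤ.suc a) k below′ above′
    where
    below′ : ∀ j → j < ℤ.suc a → P j
    below′ j j<1+a with j ℤ.≟ a
    ... | yes refl = Pa
    ... | no  j≢a  = below j (≤∧≢⇒< (subst (j ≤_) (pred-suc a) (i<j⇒i≤pred[j] j<1+a)) j≢a)
    above′ : ∀ j → ℤ.suc a + + k ≤ j → P j
    above′ j = above j ∘ subst (_≤ j) (xy∙z≈y∙xz 1ℤ a (+ k))

  largest-index : ∀ {k p} (P : Pred (Fin k) p) → Decidable P → ∃ P →
                  ∃[ i ] P i × (∀ t → P t → t Fin.≤ i)
  largest-index {suc k} P P? (t , Pt) with any? (P? ∘ suc)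
  ... | yes found with largest-index (P ∘ suc) (P? ∘ suc) found
  ...   | i , Pi , largest = suc i , Pi , λ { zero _ → ℕ.z≤n ; (suc t) Pt → ℕ.s≤s (largest t Pt) }
  largest-index {suc k} P P? (t , Pt) | no none =
    zero , only-zero t Pt , λ t Pt → ℕ.≤-reflexive (cong Fin.toℕ (at-zero t Pt))
    where
    at-zero : ∀ t → P t → t ≡ zero
    at-zero zero    _  = refl
    at-zero (suc t) Pt = contradiction (t , Pt) none
    only-zero : ∀ t → P t → P zero
    only-zero t Pt = subst P (at-zero t Pt) Pt

  sumℤ-mono : ∀ {k} (u v : Vec ℤ k) → (∀ i → lookup u i ≤ lookup v i) → sumℤ u ≤ sumℤ v
  sumℤ-mono []      []      _ = ≤-refl
  sumℤ-mono (_ ∷ u) (_ ∷ v) h = +-mono-≤ (h zero) (sumℤ-mono u v (h ∘ suc))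

  sumℤ-nonneg : ∀ {k} (u : Vec ℤ k) → (∀ i → 0ℤ ≤ lookup u i) → 0ℤ ≤ sumℤ u
  sumℤ-nonneg []      _ = ≤-refl
  sumℤ-nonneg (_ ∷ u) h = +-mono-≤ (h zero) (sumℤ-nonneg u (h ∘ suc))

  sumℤ-nonpos : ∀ {k} (u : Vec ℤ k) → (∀ i → lookup u i ≤ 0ℤ) → sumℤ u ≤ 0ℤ
  sumℤ-nonpos []      _ = ≤-refl
  sumℤ-nonpos (_ ∷ u) h = +-mono-≤ (h zero) (sumℤ-nonpos u (h ∘ suc))

  Nonnegative : ∀ {k} → Vec ℤ k → Set
  Nonnegative R = ∀ i → 0ℤ ≤ lookup R i

  ⪯-trans : ∀ {k} {R R′ R″ : Vec ℤ k} → R ⪯ R′ → R′ ⪯ R″ → R ⪯ R″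
  ⪯-trans p q i = ≤-trans (p i) (q i)

  ⪯-antisym : ∀ {k} {R R′ : Vec ℤ k} → R ⪯ R′ → R′ ⪯ R → R ≡ R′
  ⪯-antisym p q = Pointwise-≡⇒≡ (ext λ i → ≤-antisym (p i) (q i))

  ∃-upper-bound : ∀ {k} (R : Vec ℤ k) → ∃[ M ] (∀ i → lookup R i ≤ + M)
  ∃-upper-bound [] = 0 , λ ()
  ∃-upper-bound (x ∷ R) with ∃-upper-bound R
  ... | M , bound = ∣ x ∣ ℕ.+ M , λ
    { zero    → ≤-trans (i≤+∣i∣ x) (+≤+ (ℕ.m≤m+n ∣ x ∣ M))
    ; (suc i) → ≤-trans (bound i) (+≤+ (ℕ.m≤n+m M ∣ x ∣)) }

  bump : ∀ {k} → Vec ℤ k → Fin k → Vec ℤ k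
  bump R i = updateAt R i (λ r → r + 1ℤ)

  bump-⪯ : ∀ {k} (R : Vec ℤ k) i → R ⪯ bump R i
  bump-⪯ R i t with t Fin.≟ i
  ... | yes refl rewrite lookup∘updateAt t {λ r → r + 1ℤ} R = i≤i+j (lookup R t) 1ℤ
  ... | no  t≢i  rewrite lookup∘updateAt′ t i {λ r → r + 1ℤ} t≢i R = ≤-refl

  bump-⪯-bound : ∀ {k} {R B : Vec ℤ k} {i} → R ⪯ B → lookup R i < lookup B i → bump R i ⪯ B
  bump-⪯-bound {R = R} {i = i} R⪯B Ri<Bi t with t Fin.≟ i
  ... | yes refl rewrite lookup∘updateAt t {λ r → r + 1ℤ} R =
    subst (_≤ _) (+-comm 1ℤ (lookup R t)) (i<j⇒suc[i]≤j Ri<Bi)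
  ... | no  t≢i  rewrite lookup∘updateAt′ t i {λ r → r + 1ℤ} t≢i R = R⪯B t

  bump-last-wi : ∀ {k} {R : Vec ℤ k} {i} → WeaklyIncreasing R →
                 (∀ t → lookup R t ≡ lookup R i → t Fin.≤ i) → WeaklyIncreasing (bump R i)
  bump-last-wi {R = R} {i} R-wi last a b a≤b with a Fin.≟ i | b Fin.≟ i
  ... | yes refl | yes refl = ≤-refl
  ... | yes refl | no b≢i
    rewrite lookup∘updateAt a {λ r → r + 1ℤ} R | lookup∘updateAt′ b a {λ r → r + 1ℤ} b≢i R =
      subst (_≤ _) (+-comm 1ℤ (lookup R a)) (i<j⇒suc[i]≤j (≤∧≢⇒< (R-wi a b a≤b) Ra≢Rb))
    where
    Ra≢Rb : lookup R a ≢ lookup R b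
    Ra≢Rb e = b≢i (Fin.≤-antisym (last b (sym e)) a≤b)
  ... | no a≢i | yes refl
    rewrite lookup∘updateAt b {λ r → r + 1ℤ} R | lookup∘updateAt′ a b {λ r → r + 1ℤ} a≢i R =
      ≤-trans (R-wi a b a≤b) (i≤i+j (lookup R b) 1ℤ)
  ... | no a≢i | no b≢i
    rewrite lookup∘updateAt′ a i {λ r → r + 1ℤ} a≢i R | lookup∘updateAt′ b i {λ r → r + 1ℤ} b≢i R =
      R-wi a b a≤b

  gap : ∀ {k} → Vec ℤ k → Vec ℤ k → ℤ
  gap B R = sumℤ (zipWith _-_ B R)

  gap-nonneg : ∀ {k} {R B : Vec ℤ k} → R ⪯ B → 0ℤ ≤ gap B R
  gap-nonneg {R = R} {B} R⪯B = sumℤ-nonneg (zipWith _-_ B R) λ i →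
    subst (0ℤ ≤_) (sym (lookup-zipWith _-_ i B R)) (i≤j⇒0≤j-i (R⪯B i))

  gap-bump : ∀ {k} (B R : Vec ℤ k) i → gap B R ≡ 1ℤ + gap B (bump R i)
  gap-bump (b ∷ B) (r ∷ R) zero = shift b r (gap B R)
    where
    shift : ∀ b r g → b - r + g ≡ 1ℤ + (b - (r + 1ℤ) + g)
    shift = solve-∀
  gap-bump (b ∷ B) (r ∷ R) (suc i) = trans (cong (_+_ (b - r)) (gap-bump B R i)) (x∙yz≈y∙xz (b - r) 1ℤ _)

  normalize-translates : ∀ {k} (R : Vec ℤ k) → ∃[ x ] normalize R ≡ map (_- x) R
  normalize-translates []      = 0ℤ , refl
  normalize-translates (x ∷ R) = x , refl

  normalize-wi : ∀ {k} {R : Vec ℤ k} → WeaklyIncreasing R → WeaklyIncreasing (normalize R)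
  normalize-wi {R = []}    _    ()
  normalize-wi {R = x ∷ R} R-wi a b a≤b
    rewrite lookup-map a (_- x) (x ∷ R) | lookup-map b (_- x) (x ∷ R) = +-monoˡ-≤ (- x) (R-wi a b a≤b)

  normalize-fixed : ∀ {k} {R : Vec ℤ k} → Nonnegative R → R ⪯ normalize R → normalize R ≡ R
  normalize-fixed {R = []}    _     _      = refl
  normalize-fixed {R = x ∷ R} R-nonneg R⪯R̃
    with ≤-antisym (subst (x ≤_) (+-inverseʳ x) (R⪯R̃ zero)) (R-nonneg zero)
  ... | refl = trans (map-cong +-identityʳ (0ℤ ∷ R)) (map-id (0ℤ ∷ R))

  module _ (m n : ℕ) where

    Segment : Letter → ℤ → ℤ → Set
    Segment S j r = r ≤ j × j < r + + m
    Segment W j r = r - + n ≤ j × j < r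

    segment? : ∀ l j r → Dec (Segment l j r)
    segment? S j r = (r ≤? j) ×-dec (j <? r + + m)
    segment? W j r = (r - + n ≤? j) ×-dec (j <? r)

    sign : Letter → ℤ
    sign S = 1ℤ
    sign W = -1ℤ

    contrib-segment : ∀ l {j r} → Segment l j r → contrib m n j l r ≡ sign l
    contrib-segment S {j} {r} (p , q) = if-∧-yes (r ≤? j) (j <? r + + m) p q
    contrib-segment W {j} {r} (p , q) = if-∧-yes (r - + n ≤? j) (j <? r) p q

    contrib-¬segment : ∀ l {j r} → ¬ Segment l j r → contrib m n j l r ≡ 0ℤ
    contrib-¬segment S {j} {r} ¬s = if-∧-no (r ≤? j) (j <? r + + m) ¬s
    contrib-¬segment W {j} {r} ¬s = if-∧-no (r - + n ≤? j) (j <? r) ¬s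

    contrib-segments : ∀ l {j r j′ r′} → Segment l j r → Segment l j′ r′ →
                       contrib m n j l r ≡ contrib m n j′ l r′
    contrib-segments l s s′ = trans (contrib-segment l s) (sym (contrib-segment l s′))

    contrib-resp : ∀ l {j r j′ r′} →
                   (Segment l j r → Segment l j′ r′) → (Segment l j′ r′ → Segment l j r) →
                   contrib m n j l r ≡ contrib m n j′ l r′
    contrib-resp l {j} {r} to from with segment? l j r
    ... | yes s = contrib-segments l s (to s)
    ... | no ¬s = trans (contrib-¬segment l ¬s) (sym (contrib-¬segment l (¬s ∘ from)))

    red-contrib-nonneg : ∀ j r → 0ℤ ≤ contrib m n j S r
    red-contrib-nonneg j r with segment? S j r
    ... | yes s rewrite contrib-segment S s = +≤+ ℕ.z≤n
    ... | no ¬s rewrite contrib-¬segment S ¬s = ≤-refl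

    blue-contrib-nonpos : ∀ j r → contrib m n j W r ≤ 0ℤ
    blue-contrib-nonpos j r with segment? W j r
    ... | yes s rewrite contrib-segment W s = -≤+
    ... | no ¬s rewrite contrib-¬segment W ¬s = ≤-refl

    segment-within : ∀ l {j r} → Segment l j r → r - + n ≤ j × j < r + + m
    segment-within S {r = r} (r≤j , j<r+m) = ≤-trans (i-j≤i r (+ n)) r≤j , j<r+m
    segment-within W         (r-n≤j , j<r) = r-n≤j , <-≤-trans j<r (i≤i+j _ (+ m))

    contrib-below : ∀ l {j r} → j < r - + n → contrib m n j l r ≡ 0ℤ
    contrib-below l j<r-n = contrib-¬segment l (<⇒≱ j<r-n ∘ proj₁ ∘ segment-within l)

    contrib-above : ∀ l {j r} → r + + m ≤ j → contrib m n j l r ≡ 0ℤ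
    contrib-above l r+m≤j = contrib-¬segment l (λ s → <⇒≱ (proj₂ (segment-within l s)) r+m≤j)

    segment-translate : ∀ l {j r} x → Segment l j r → Segment l (j + x) (r + x)
    segment-translate S {j} {r} x (r≤j , j<r+m) =
      +-monoˡ-≤ x r≤j , subst (j + x <_) (xy∙z≈xz∙y r (+ m) x) (+-monoˡ-< x j<r+m)
    segment-translate W {j} {r} x (r-n≤j , j<r) =
      subst (_≤ j + x) (xy∙z≈xz∙y r (- + n) x) (+-monoˡ-≤ x r-n≤j) , +-monoˡ-< x j<r

    contrib-translate : ∀ l j r x → contrib m n j l (r - x) ≡ contrib m n (j + x) l r
    contrib-translate l j r x = contrib-resp l
      (subst (Segment l (j + x)) (i-j+j≡i r x) ∘ segment-translate l x)
      (subst (λ j′ → Segment l j′ (r - x)) (i+j-j≡i j x) ∘ segment-translate l (- x))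

    contrib-mono-rank : ∀ l {j q r} → q ≤ r → (q ≤ j → r ≤ j) → contrib m n j l q ≤ contrib m n j l r
    contrib-mono-rank S {j} {q} {r} q≤r below with segment? S j q
    ... | yes (q≤j , j<q+m) =
      ≤-reflexive (contrib-segments S (q≤j , j<q+m) (below q≤j , <-≤-trans j<q+m (+-monoˡ-≤ (+ m) q≤r)))
    ... | no ¬s rewrite contrib-¬segment S ¬s = red-contrib-nonneg j r
    contrib-mono-rank W {j} {q} {r} q≤r below with segment? W j r
    ... | yes (r-n≤j , j<r) =
      ≤-reflexive (contrib-segments W
        (≤-trans (+-monoˡ-≤ (- + n) q≤r) r-n≤j , ≰⇒> (<⇒≱ j<r ∘ below)) (r-n≤j , j<r))
    ... | no ¬s rewrite contrib-¬segment W ¬s = blue-contrib-nonpos j q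

    contrib-≤-pred-row : ∀ l {j r} → r ≢ j → contrib m n j l r ≤ contrib m n (pred j) l r
    contrib-≤-pred-row S {j} {r} r≢j with segment? S j r
    ... | yes (r≤j , j<r+m) =
      ≤-reflexive (contrib-segments S (r≤j , j<r+m)
        (i<j⇒i≤pred[j] (≤∧≢⇒< r≤j r≢j) , ≤-<-trans (i≤j⇒pred[i]≤j ≤-refl) j<r+m))
    ... | no ¬s rewrite contrib-¬segment S ¬s = red-contrib-nonneg (pred j) r
    contrib-≤-pred-row W {j} {r} r≢j with segment? W (pred j) r
    ... | yes (r-n≤j-1 , j-1<r) =
      ≤-reflexive (contrib-segments W
        (≤-trans r-n≤j-1 (i≤j⇒pred[i]≤j ≤-refl) ,
         ≤∧≢⇒< (subst (_≤ r) (suc-pred j) (i<j⇒suc[i]≤j j-1<r)) (r≢j ∘ sym))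
        (r-n≤j-1 , j-1<r))
    ... | no ¬s rewrite contrib-¬segment W ¬s = blue-contrib-nonpos j r

    module _ (w : List Letter) where

      private
        Ranks : Set
        Ranks = Vec ℤ (length w)

        c : Ranks → ℤ → ℤ
        c = rowCount m n w

        letter : Fin (length w) → Letter
        letter = lookup (fromList w)

      rowCount-mono : ∀ {Q R : Ranks} {j j′} →
        (∀ t → contrib m n j (letter t) (lookup Q t) ≤ contrib m n j′ (letter t) (lookup R t)) → c Q j ≤ c R j′
      rowCount-mono {Q} {R} {j} {j′} h =
        sumℤ-mono (zipWith (contrib m n j) (fromList w) Q) (zipWith (contrib m n j′) (fromList w) R) λ t →
        subst₂ _≤_ (sym (lookup-zipWith (contrib m n j) t (fromList w) Q))
                   (sym (lookup-zipWith (contrib m n j′) t (fromList w) R)) (h t)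

      rowCount-cong : ∀ {Q R : Ranks} {j j′} →
        (∀ t → contrib m n j (letter t) (lookup Q t) ≡ contrib m n j′ (letter t) (lookup R t)) → c Q j ≡ c R j′
      rowCount-cong {Q} {R} {j} {j′} h = cong sumℤ
        (Pointwise-≡⇒≡ {xs = zipWith (contrib m n j) (fromList w) Q} {zipWith (contrib m n j′) (fromList w) R}
        (ext λ t → trans (lookup-zipWith (contrib m n j) t (fromList w) Q)
                         (trans (h t) (sym (lookup-zipWith (contrib m n j′) t (fromList w) R)))))

      rowCount-nonpos : ∀ {Q : Ranks} {j} → (∀ t → contrib m n j (letter t) (lookup Q t) ≤ 0ℤ) → c Q j ≤ 0ℤ
      rowCount-nonpos {Q} {j} h = sumℤ-nonpos (zipWith (contrib m n j) (fromList w) Q) λ t →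
        subst (_≤ 0ℤ) (sym (lookup-zipWith (contrib m n j) t (fromList w) Q)) (h t)

      rowCount-mono-rank : ∀ {Q R : Ranks} j → Q ⪯ R → (∀ t → lookup Q t ≤ j → lookup R t ≤ j) →
                           c Q j ≤ c R j
      rowCount-mono-rank {Q} {R} j Q⪯R below =
        rowCount-mono {Q} {R} λ t → contrib-mono-rank (letter t) (Q⪯R t) (below t)

      rowCount-≤-pred-row : ∀ {Q : Ranks} {j} → (∀ t → lookup Q t ≢ j) → c Q j ≤ c Q (pred j)
      rowCount-≤-pred-row {Q} none = rowCount-mono {Q} {Q} λ t → contrib-≤-pred-row (letter t) (none t)

      rowCount-translate : ∀ (R : Ranks) x j → c (map (_- x) R) j ≡ c R (j + x)
      rowCount-translate R x j = rowCount-cong {map (_- x) R} {R} λ t →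
        trans (cong (contrib m n j (letter t)) (lookup-map t (_- x) R)) (contrib-translate (letter t) j (lookup R t) x)

      stopped-normalize : ∀ {R : Ranks} → Stopped m n w R → Stopped m n w (normalize R)
      stopped-normalize {R} R-stopped j with normalize-translates R
      ... | x , R̃≡ = subst (λ R̃ → c R̃ j ≤ 0ℤ) (sym R̃≡)
                       (subst (_≤ 0ℤ) (sym (rowCount-translate R x j)) (R-stopped (j + x)))

      rowCount-outside : ∀ {Q : Ranks} {M} → Nonnegative Q → (∀ t → lookup Q t ≤ + M) →
        ∀ j → j < - + n ⊎ + M + + m ≤ j → c Q j ≤ 0ℤ
      rowCount-outside {Q} Q-nonneg Q≤M j (inj₁ j<-n) = rowCount-nonpos {Q} λ t → ≤-reflexive
        (contrib-below (letter t) (<-≤-trans j<-n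
          (subst (_≤ lookup Q t - + n) (+-identityˡ (- + n)) (+-monoˡ-≤ (- + n) (Q-nonneg t)))))
      rowCount-outside {Q} {M} Q-nonneg Q≤M j (inj₂ M+m≤j) = rowCount-nonpos {Q} λ t → ≤-reflexive
        (contrib-above (letter t) (≤-trans (+-monoˡ-≤ (+ m) (Q≤M t)) M+m≤j))

      LowestPositiveRow : Ranks → ℤ → Set
      LowestPositiveRow Q j = 0ℤ < c Q j × (∀ j′ → j′ < j → c Q j′ ≤ 0ℤ)

      stopped⊎lowestPositiveRow : ∀ {Q : Ranks} {M} → Nonnegative Q → (∀ t → lookup Q t ≤ + M) →
        Stopped m n w Q ⊎ ∃ (LowestPositiveRow Q)
      stopped⊎lowestPositiveRow {Q} {M} Q-nonneg Q≤M
        with least-counterexample (λ j → c Q j ≤ 0ℤ) (λ j → c Q j ≤? 0ℤ) (- + n) (n ℕ.+ (M ℕ.+ m))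
               (λ j j<-n → rowCount-outside Q-nonneg Q≤M j (inj₁ j<-n))
               (λ j p → rowCount-outside Q-nonneg Q≤M j (inj₂ (subst (_≤ j) (window-top M) p)))
        where
        window-top : ∀ M → - + n + + (n ℕ.+ (M ℕ.+ m)) ≡ + M + + m
        window-top M rewrite pos-+ n (M ℕ.+ m) | pos-+ M m = cancel (+ n) (+ M) (+ m)
          where
          cancel : ∀ a b c → - a + (a + (b + c)) ≡ b + c
          cancel = solve-∀
      ... | inj₁ stopped = inj₁ stopped
      ... | inj₂ (j , c≰0 , lower) = inj₂ (j , ≰⇒> c≰0 , lower)

      lowestPositiveRow-has-start : ∀ {Q : Ranks} {j} → LowestPositiveRow Q j → ∃[ i ] lookup Q i ≡ j
      lowestPositiveRow-has-start {Q} {j} (positive , lower) with any? (λ i → lookup Q i ℤ.≟ j)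
      ... | yes found = found
      ... | no  none  = contradiction
        (≤-trans (rowCount-≤-pred-row (λ i e → none (i , e))) (lower (pred j) (i≤pred[j]⇒i<j ≤-refl)))
        (<⇒≱ positive)

      _↝_ : Ranks → Ranks → Set
      _↝_ = Step m n w

      _↝*_ : Ranks → Ranks → Set
      _↝*_ = Star _↝_

      stopped⊎step : ∀ {Q : Ranks} {M} → Nonnegative Q → (∀ t → lookup Q t ≤ + M) →
                     Stopped m n w Q ⊎ ∃ (Q ↝_)
      stopped⊎step {Q} Q-nonneg Q≤M with stopped⊎lowestPositiveRow Q-nonneg Q≤M
      ... | inj₁ stopped = inj₁ stopped
      ... | inj₂ (j , positive , lower)
        with largest-index (λ i → lookup Q i ≡ j) (λ i → lookup Q i ℤ.≟ j)
               (lowestPositiveRow-has-start (positive , lower))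
      ...   | i , Qi≡j , last = inj₂ (bump Q i , j , i , positive , lower , Qi≡j , last , refl)

      step-⪯ : ∀ {Q Q′} → Q ↝ Q′ → Q ⪯ Q′
      step-⪯ {Q} (_ , i , _ , _ , _ , _ , refl) = bump-⪯ Q i

      step-wi : ∀ {Q Q′} → WeaklyIncreasing Q → Q ↝ Q′ → WeaklyIncreasing Q′
      step-wi {Q} Q-wi (_ , _ , _ , _ , refl , last , refl) = bump-last-wi {R = Q} Q-wi last

      step-below-stopped : ∀ {B Q Q′} → WeaklyIncreasing B → Stopped m n w B →
        WeaklyIncreasing Q → Q ⪯ B → Q ↝ Q′ → Q′ ⪯ B
      step-below-stopped {B} {Q} B-wi B-stopped Q-wi Q⪯B (j , i , positive , _ , refl , last , refl) =
        bump-⪯-bound {R = Q} {B} Q⪯B (≰⇒> Bi≰Qi)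
        where
        Bi≰Qi : ¬ lookup B i ≤ lookup Q i
        Bi≰Qi Bi≤Qi = <⇒≱ positive (≤-trans (rowCount-mono-rank (lookup Q i) Q⪯B below) (B-stopped (lookup Q i)))
          where
          below : ∀ t → lookup Q t ≤ lookup Q i → lookup B t ≤ lookup Q i
          below t Qt≤Qi with t Fin.≤? i
          ... | yes t≤i = ≤-trans (B-wi t i t≤i) Bi≤Qi
          ... | no  t≰i = contradiction (last t (≤-antisym Qt≤Qi (Q-wi i t (ℕ.<⇒≤ (ℕ.≰⇒> t≰i))))) t≰i

      ↝*-⪯ : ∀ {Q Q′} → Q ↝* Q′ → Q ⪯ Q′
      ↝*-⪯ = fold _⪯_ (λ s p t → ≤-trans (step-⪯ s t) (p t)) (λ _ → ≤-refl)

      ↝*-wi : ∀ {Q Q′} → Q ↝* Q′ → WeaklyIncreasing Q → WeaklyIncreasing Q′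
      ↝*-wi = fold (λ X Y → WeaklyIncreasing X → WeaklyIncreasing Y)
        (λ s k X-wi → k (step-wi X-wi s)) (λ X-wi → X-wi)

      ↝*-below-stopped : ∀ {B Q Q′} → WeaklyIncreasing B → Stopped m n w B →
        Q ↝* Q′ → WeaklyIncreasing Q → Q ⪯ B → Q′ ⪯ B
      ↝*-below-stopped {B} B-wi B-stopped = fold (λ X Y → WeaklyIncreasing X → X ⪯ B → Y ⪯ B)
        (λ s k X-wi X⪯B → k (step-wi X-wi s) (step-below-stopped B-wi B-stopped X-wi X⪯B s))
        (λ _ X⪯B → X⪯B)

      gap-step : ∀ B {Q Q′} → Q ↝ Q′ → gap B Q ≡ 1ℤ + gap B Q′
      gap-step B {Q} (_ , i , _ , _ , _ , _ , refl) = gap-bump B Q i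

      runs-to-stopped : ∀ {B Q} → WeaklyIncreasing B → Stopped m n w B →
        WeaklyIncreasing Q → Nonnegative Q → Q ⪯ B →
        ∃[ Q* ] Q ↝* Q* × Stopped m n w Q* × Q* ⪯ B
      runs-to-stopped {B} {Q} B-wi B-stopped = run ∣ gap B Q ∣ (i≤+∣i∣ (gap B Q))
        where
        run : ∀ fuel {Q} → gap B Q ≤ + fuel → WeaklyIncreasing Q → Nonnegative Q → Q ⪯ B →
              ∃[ Q* ] Q ↝* Q* × Stopped m n w Q* × Q* ⪯ B
        run fuel gap≤fuel Q-wi Q-nonneg Q⪯B
          with stopped⊎step Q-nonneg (λ t → ≤-trans (Q⪯B t) (proj₂ (∃-upper-bound B) t))
        run fuel gap≤fuel Q-wi Q-nonneg Q⪯B | inj₁ stopped = _ , ε , stopped , Q⪯B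
        run zero gap≤0 Q-wi Q-nonneg Q⪯B | inj₂ (Q′ , s) = contradiction
          (gap-nonneg {R = Q′} {B} (step-below-stopped B-wi B-stopped Q-wi Q⪯B s))
          (<⇒≱ (suc[i]≤j⇒i<j (subst (_≤ 0ℤ) (gap-step B s) gap≤0)))
        run (suc f) gap≤1+f Q-wi Q-nonneg Q⪯B | inj₂ (Q′ , s)
          with run f (i<j⇒i≤pred[j] (suc[i]≤j⇒i<j (subst (_≤ + suc f) (gap-step B s) gap≤1+f)))
                 (step-wi Q-wi s) (λ t → ≤-trans (Q-nonneg t) (step-⪯ s t))
                 (step-below-stopped B-wi B-stopped Q-wi Q⪯B s)
        ... | Q* , Q′↝*Q* , stopped , Q*⪯B = Q* , s ◅ Q′↝*Q* , stopped , Q*⪯B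

      outputs-from-between : ∀ {R⁰ R B : Ranks} → WeaklyIncreasing R⁰ → Nonnegative R⁰ →
        WeakFindRankOutputs m n w R⁰ B → WeaklyIncreasing R → R⁰ ⪯ R → R ⪯ B → WeakFindRankOutputs m n w R B
      outputs-from-between {R⁰} {R} {B} R⁰-wi R⁰-nonneg (R⁰↝*B , B-stopped) R-wi R⁰⪯R R⪯B
        with runs-to-stopped (↝*-wi R⁰↝*B R⁰-wi) B-stopped R-wi (λ t → ≤-trans (R⁰-nonneg t) (R⁰⪯R t)) R⪯B
      ... | Q , R↝*Q , Q-stopped , Q⪯B = subst (WeakFindRankOutputs m n w R) Q≡B (R↝*Q , Q-stopped)
        where
        B⪯Q : B ⪯ Q
        B⪯Q = ↝*-below-stopped (↝*-wi R↝*Q R-wi) Q-stopped R⁰↝*B R⁰-wi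
                (⪯-trans {R = R⁰} {R} {Q} R⁰⪯R (↝*-⪯ R↝*Q))
        Q≡B : Q ≡ B
        Q≡B = ⪯-antisym Q⪯B B⪯Q

      normalize-output : ∀ {R⁰ R̄ : Ranks} → WeaklyIncreasing R⁰ → Nonnegative R⁰ →
        R⁰ ↝* R̄ → Stopped m n w R̄ → R⁰ ⪯ normalize R̄ → normalize R̄ ≡ R̄
      normalize-output {R̄ = R̄} R⁰-wi R⁰-nonneg R⁰↝*R̄ R̄-stopped R⁰⪯R̃ = normalize-fixed {R = R̄}
        (λ t → ≤-trans (R⁰-nonneg t) (↝*-⪯ R⁰↝*R̄ t))
        (↝*-below-stopped (normalize-wi {R = R̄} (↝*-wi R⁰↝*R̄ R⁰-wi)) (stopped-normalize {R̄} R̄-stopped)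
          R⁰↝*R̄ R⁰-wi R⁰⪯R̃)

  canonStart-nonneg : ∀ m w → Nonnegative (canonStart m w)
  canonStart-nonneg m (S List.∷ w) zero    = ≤-refl
  canonStart-nonneg m (S List.∷ w) (suc i) = canonStart-nonneg m w i
  canonStart-nonneg m (W List.∷ w) i       = subst (0ℤ ≤_) (sym (lookup-replicate i (+ m))) (+≤+ ℕ.z≤n)

  canonStart-wi : ∀ m w → WeaklyIncreasing (canonStart m w)
  canonStart-wi m (S List.∷ w) zero    b       _   = canonStart-nonneg m (S List.∷ w) b
  canonStart-wi m (S List.∷ w) (suc a) (suc b) a≤b = canonStart-wi m w a b (ℕ.≤-pred a≤b)
  canonStart-wi m (W List.∷ w) a       b       _   =
    ≤-reflexive (trans (lookup-replicate a (+ m)) (sym (lookup-replicate b (+ m))))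

open import Data.Nat using (ℕ; _<_)
open import Data.Nat.Coprimality using (Coprime)
open import Data.Integer using (ℤ)
open import Data.List using (List; length)
open import Data.Vec using (Vec)
open import Data.Product using (_,_)
open import Relation.Binary.PropositionalEquality using (refl)

theorem4 : (m n : ℕ) → 0 < m → 0 < n → Coprime m n →
    (w : List Letter) → IsDyckWord m n w →
    (Rt : Vec ℤ (length w)) → IsCanonicalRank m n w Rt →
    (R : Vec ℤ (length w)) → WeaklyIncreasing R →
    canonStart m w ⪯ R → R ⪯ Rt →
    WeakFindRankOutputs m n w R Rt
theorem4 m n _ _ _ w _ _ (R̄ , (R⁰↝*R̄ , R̄-stopped) , refl) R R-wi R⁰⪯R R⪯Rt =
  outputs-from-between m n w (canonStart-wi m w) (canonStart-nonneg m w) R⁰-outputs R-wi R⁰⪯R R⪯Rt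
  where
  R⁰-outputs : WeakFindRankOutputs m n w (canonStart m w) (normalize R̄)
  R⁰-outputs rewrite normalize-output m n w (canonStart-wi m w) (canonStart-nonneg m w) R⁰↝*R̄ R̄-stopped
                       (⪯-trans {R = canonStart m w} {R} {normalize R̄} R⁰⪯R R⪯Rt) = R⁰↝*R̄ , R̄-stopped
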